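{- (1) If $\mathbf{HLJ}'+(\mathrm{rs})$ derives $\Gamma_1\Rightarrow\Delta_1\mid\cdots\mid\Gamma_n\Rightarrow\Delta_n$, then $\bigvee_{i=1}^{n}(\bigwedge\Gamma_i\to\bigvee\Delta_i)$ is $\mathbf{GD}$-valid. (2) If $\forall\mathbf{HLJ}'+(\forall\text{ - }\mathrm{R_{ms}})+(\mathrm{rs})$ derives $\Gamma_1\Rightarrow\Delta_1\mid\cdots\mid\Gamma_n\Rightarrow\Delta_n$, then the universal closure of $\bigvee_{i=1}^{n}(\bigwedge\Gamma_i\to\bigvee\Delta_i)$ is $\forall\mathbf{GD}$-valid.
   Context: Formulas are built from atoms and $\bot$ with $\land,\lor,\to$ (and, in the predicate case, $\forall,\exists$). A sequent $\Gamma\Rightarrow\Delta$ consists of finite sequences of formulas; a hypersequent is a finite sequence of sequents $\Gamma_1\Rightarrow\Delta_1\mid\cdots\mid\Gamma_n\Rightarrow\Delta_n$; $G,H$ denote possibly empty hypersequents, $S,T$ sequents. An empty conjunction is $\top$ and an empty disjunction is $\bot$. $\mathbf{HLK}$ has: axioms $\varphi\Rightarrow\varphi$, $\bot\Rightarrow\varphi$; external weakening (from $G$ infer $S\mid G$), contraction (from $S\mid S\mid G$ infer $S\mid G$), exchange (from $G\mid S\mid T\mid H$ infer $G\mid T\mid S\mid H$); internal weakening, contraction and exchange on either side of a component, with arbitrary side hypersequent $G$; cut: from $\Gamma_0\Rightarrow\Delta_0,\delta\mid G$ and $\delta,\Gamma_1\Rightarrow\Delta_1\mid G$ infer $\Gamma_0,\Gamma_1\Rightarrow\Delta_0,\Delta_1\mid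 G$; the classical multi-succedent logical rules for $\land,\lor,\to$ applied to one component with arbitrary side hypersequent $G$ (e.g. from $\Gamma\Rightarrow\Delta,\varphi\mid G$ and $\psi,\Gamma\Rightarrow\Delta\mid G$ infer $\varphi\to\psi,\Gamma\Rightarrow\Delta\mid G$; from $\varphi,\Gamma\Rightarrow\Delta,\psi\mid G$ infer $\Gamma\Rightarrow\Delta,\varphi\to\psi\mid G$; from $\varphi_1,\Gamma\Rightarrow\Delta\mid G$ and $\varphi_2,\Gamma\Rightarrow\Delta\mid G$ infer $\varphi_1\lor\varphi_2,\Gamma\Rightarrow\Delta\mid G$; from $\Gamma\Rightarrow\Delta,\varphi_i\mid G$ infer $\Gamma\Rightarrow\Delta,\varphi_1\lor\varphi_2\mid G$; from $\varphi_i,\Gamma\Rightarrow\Delta\mid G$ infer $\varphi_1\land\varphi_2,\Gamma\Rightarrow\Delta\mid G$; from $\Gamma\Rightarrow\Delta,\varphi_1\mid G$ and $\Gamma\Rightarrow\Delta,\varphi_2\mid G$ infer $\Gamma\Rightarrow\Delta,\varphi_1\land\varphi_2\mid G$). $\mathbf{HLJ}'$ is $\mathbf{HLK}$ with the $\to$-right rule replaced by: from $\varphi,\Gamma\Rightarrow\psi\mid G$ infer $\Gamma\Rightarrow\varphi\to\psi\mid G$. $\forall\mathbf{HLJ}'$ is $\mathbf{HLJ}'$ plus: from $[t/x]\varphi,\Gamma\Rightarrow\Delta\mid G$ infer $\forall x\varphi,\Gamma\Rightarrow\Delta\mid G$; from $\Gamma\Rightarrow\varphi$ infer $\Gamma\Rightarrow\forall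 x\varphi$ (single component, $x$ not free in $\Gamma$); from $\varphi,\Gamma\Rightarrow\Delta$ infer $\exists x\varphi,\Gamma\Rightarrow\Delta$ (single component, $x$ not free in $\Gamma,\Delta$); from $\Gamma\Rightarrow\Delta,[t/x]\psi\mid G$ infer $\Gamma\Rightarrow\Delta,\exists x\psi\mid G$. $(\forall\text{ - }\mathrm{R_{ms}})$: from $\Gamma\Rightarrow\varphi\mid G$ infer $\Gamma\Rightarrow\forall x\varphi\mid G$, $x$ not free in the conclusion. $(\mathrm{rs})$: from $\Gamma\Rightarrow\Delta_1,\Delta_2\mid G$ infer $\Gamma\Rightarrow\Delta_1\mid\Gamma\Rightarrow\Delta_2\mid G$. $\mathbf{GD}$ is intuitionistic propositional logic plus $\mathsf{LIN}\colon(\varphi\to\psi)\lor(\psi\to\varphi)$; $\forall\mathbf{GD}$ is intuitionistic predicate logic plus $\mathsf{LIN}$ and $\mathsf{ACD}\colon\forall x(\varphi\lor\psi(x))\to\varphi\lor\forall x\psi(x)$ ($x$ not free in $\varphi$). "$L$-valid" means valid (equivalently provable) in $L$. -}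

module Defs where

open import Data.Nat using (ℕ; zero; suc; _⊔_; _∸_)
open import Data.List using (List; []; _∷_; _++_; _∷ʳ_; map)

module Prop where

  infixr 6 _∧ᶠ_
  infixr 5 _∨ᶠ_
  infixr 4 _→ᶠ_
  infix 3 _⇒_

  data Fm : Set where
    atom : ℕ → Fm
    ⊥ᶠ   : Fm
    _∧ᶠ_ _∨ᶠ_ _→ᶠ_ : Fm → Fm → Fm

  ⊤ᶠ : Fm
  ⊤ᶠ = ⊥ᶠ →ᶠ ⊥ᶠ

  ⋀ : List Fm → Fm
  ⋀ []           = ⊤ᶠ
  ⋀ (φ ∷ [])     = φ
  ⋀ (φ ∷ ψ ∷ Γ)  = φ ∧ᶠ ⋀ (ψ ∷ Γ)

  ⋁ : List Fm → Fm
  ⋁ []           = ⊥ᶠ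
  ⋁ (φ ∷ [])     = φ
  ⋁ (φ ∷ ψ ∷ Γ)  = φ ∨ᶠ ⋁ (ψ ∷ Γ)

  record Seq : Set where
    constructor _⇒_
    field
      ante : List Fm
      succ : List Fm

  HSeq : Set
  HSeq = List Seq

  data HLJ'rs : HSeq → Set where
    ax   : ∀ φ → HLJ'rs ((φ ∷ [] ⇒ φ ∷ []) ∷ [])
    ax⊥  : ∀ φ → HLJ'rs ((⊥ᶠ ∷ [] ⇒ φ ∷ []) ∷ [])
    ew   : ∀ {S G} → HLJ'rs G → HLJ'rs (S ∷ G)
    ec   : ∀ {S G} → HLJ'rs (S ∷ S ∷ G) → HLJ'rs (S ∷ G)
    ee   : ∀ {G S T H} → HLJ'rs (G ++ S ∷ T ∷ H) → HLJ'rs (G ++ T ∷ S ∷ H)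
    iwl  : ∀ {φ Γ Δ G} → HLJ'rs ((Γ ⇒ Δ) ∷ G) → HLJ'rs ((φ ∷ Γ ⇒ Δ) ∷ G)
    iwr  : ∀ {φ Γ Δ G} → HLJ'rs ((Γ ⇒ Δ) ∷ G) → HLJ'rs ((Γ ⇒ Δ ∷ʳ φ) ∷ G)
    icl  : ∀ {φ Γ Δ G} → HLJ'rs ((φ ∷ φ ∷ Γ ⇒ Δ) ∷ G) → HLJ'rs ((φ ∷ Γ ⇒ Δ) ∷ G)
    icr  : ∀ {φ Γ Δ G} → HLJ'rs ((Γ ⇒ Δ ∷ʳ φ ∷ʳ φ) ∷ G) → HLJ'rs ((Γ ⇒ Δ ∷ʳ φ) ∷ G)
    iel  : ∀ {φ ψ Γ₁ Γ₂ Δ G} → HLJ'rs ((Γ₁ ++ φ ∷ ψ ∷ Γ₂ ⇒ Δ) ∷ G)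
                             → HLJ'rs ((Γ₁ ++ ψ ∷ φ ∷ Γ₂ ⇒ Δ) ∷ G)
    ier  : ∀ {φ ψ Γ Δ₁ Δ₂ G} → HLJ'rs ((Γ ⇒ Δ₁ ++ φ ∷ ψ ∷ Δ₂) ∷ G)
                             → HLJ'rs ((Γ ⇒ Δ₁ ++ ψ ∷ φ ∷ Δ₂) ∷ G)
    cut  : ∀ {δ Γ₀ Δ₀ Γ₁ Δ₁ G} → HLJ'rs ((Γ₀ ⇒ Δ₀ ∷ʳ δ) ∷ G) → HLJ'rs ((δ ∷ Γ₁ ⇒ Δ₁) ∷ G)
                               → HLJ'rs ((Γ₀ ++ Γ₁ ⇒ Δ₀ ++ Δ₁) ∷ G)
    →l   : ∀ {φ ψ Γ Δ G} → HLJ'rs ((Γ ⇒ Δ ∷ʳ φ) ∷ G) → HLJ'rs ((ψ ∷ Γ ⇒ Δ) ∷ G)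
                         → HLJ'rs (((φ →ᶠ ψ) ∷ Γ ⇒ Δ) ∷ G)
    →r   : ∀ {φ ψ Γ G} → HLJ'rs ((φ ∷ Γ ⇒ ψ ∷ []) ∷ G) → HLJ'rs ((Γ ⇒ (φ →ᶠ ψ) ∷ []) ∷ G)
    ∨l   : ∀ {φ₁ φ₂ Γ Δ G} → HLJ'rs ((φ₁ ∷ Γ ⇒ Δ) ∷ G) → HLJ'rs ((φ₂ ∷ Γ ⇒ Δ) ∷ G)
                           → HLJ'rs (((φ₁ ∨ᶠ φ₂) ∷ Γ ⇒ Δ) ∷ G)
    ∨r₁  : ∀ {φ₁ φ₂ Γ Δ G} → HLJ'rs ((Γ ⇒ Δ ∷ʳ φ₁) ∷ G) → HLJ'rs ((Γ ⇒ Δ ∷ʳ (φ₁ ∨ᶠ φ₂)) ∷ G)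
    ∨r₂  : ∀ {φ₁ φ₂ Γ Δ G} → HLJ'rs ((Γ ⇒ Δ ∷ʳ φ₂) ∷ G) → HLJ'rs ((Γ ⇒ Δ ∷ʳ (φ₁ ∨ᶠ φ₂)) ∷ G)
    ∧l₁  : ∀ {φ₁ φ₂ Γ Δ G} → HLJ'rs ((φ₁ ∷ Γ ⇒ Δ) ∷ G) → HLJ'rs (((φ₁ ∧ᶠ φ₂) ∷ Γ ⇒ Δ) ∷ G)
    ∧l₂  : ∀ {φ₁ φ₂ Γ Δ G} → HLJ'rs ((φ₂ ∷ Γ ⇒ Δ) ∷ G) → HLJ'rs (((φ₁ ∧ᶠ φ₂) ∷ Γ ⇒ Δ) ∷ G)
    ∧r   : ∀ {φ₁ φ₂ Γ Δ G} → HLJ'rs ((Γ ⇒ Δ ∷ʳ φ₁) ∷ G) → HLJ'rs ((Γ ⇒ Δ ∷ʳ φ₂) ∷ G)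
                           → HLJ'rs ((Γ ⇒ Δ ∷ʳ (φ₁ ∧ᶠ φ₂)) ∷ G)
    rs   : ∀ {Γ Δ₁ Δ₂ G} → HLJ'rs ((Γ ⇒ Δ₁ ++ Δ₂) ∷ G) → HLJ'rs ((Γ ⇒ Δ₁) ∷ (Γ ⇒ Δ₂) ∷ G)

  data GD⊢ : Fm → Set where
    k    : ∀ {φ ψ} → GD⊢ (φ →ᶠ ψ →ᶠ φ)
    s    : ∀ {φ ψ χ} → GD⊢ ((φ →ᶠ ψ →ᶠ χ) →ᶠ (φ →ᶠ ψ) →ᶠ φ →ᶠ χ)
    ∧e₁  : ∀ {φ ψ} → GD⊢ (φ ∧ᶠ ψ →ᶠ φ)
    ∧e₂  : ∀ {φ ψ} → GD⊢ (φ ∧ᶠ ψ →ᶠ ψ)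
    ∧i   : ∀ {φ ψ} → GD⊢ (φ →ᶠ ψ →ᶠ φ ∧ᶠ ψ)
    ∨i₁  : ∀ {φ ψ} → GD⊢ (φ →ᶠ φ ∨ᶠ ψ)
    ∨i₂  : ∀ {φ ψ} → GD⊢ (ψ →ᶠ φ ∨ᶠ ψ)
    ∨e   : ∀ {φ ψ χ} → GD⊢ ((φ →ᶠ χ) →ᶠ (ψ →ᶠ χ) →ᶠ φ ∨ᶠ ψ →ᶠ χ)
    efq  : ∀ {φ} → GD⊢ (⊥ᶠ →ᶠ φ)
    lin  : ∀ {φ ψ} → GD⊢ ((φ →ᶠ ψ) ∨ᶠ (ψ →ᶠ φ))
    mp   : ∀ {φ ψ} → GD⊢ (φ →ᶠ ψ) → GD⊢ φ → GD⊢ ψ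

  seqFm : Seq → Fm
  seqFm (Γ ⇒ Δ) = ⋀ Γ →ᶠ ⋁ Δ

  hseqFm : HSeq → Fm
  hseqFm H = ⋁ (map seqFm H)

-- Predicate part: ∀HLJ' + (∀-R_ms) + (rs) and ∀GD
-- Variables are de Bruijn indices; ∀ᶠ φ / ∃ᶠ φ bind index 0 of the body φ.

module Pred where

  infixr 6 _∧ᶠ_
  infixr 5 _∨ᶠ_
  infixr 4 _→ᶠ_
  infix 3 _⇒_

  data Tm : Set where
    var : ℕ → Tm
    fn  : ℕ → List Tm → Tm

  data Fm : Set where
    pr   : ℕ → List Tm → Fm
    ⊥ᶠ   : Fm
    _∧ᶠ_ _∨ᶠ_ _→ᶠ_ : Fm → Fm → Fm
    ∀ᶠ ∃ᶠ : Fm → Fm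

  Sub : Set
  Sub = ℕ → Tm

  mutual
    substT : Sub → Tm → Tm
    substT σ (var n)   = σ n
    substT σ (fn f ts) = fn f (substTs σ ts)

    substTs : Sub → List Tm → List Tm
    substTs σ []       = []
    substTs σ (t ∷ ts) = substT σ t ∷ substTs σ ts

  wkSub : Sub
  wkSub n = var (suc n)

  lift : Sub → Sub
  lift σ zero    = var zero
  lift σ (suc n) = substT wkSub (σ n)

  substF : Sub → Fm → Fm
  substF σ (pr p ts) = pr p (substTs σ ts)
  substF σ ⊥ᶠ        = ⊥ᶠ
  substF σ (φ ∧ᶠ ψ)  = substF σ φ ∧ᶠ substF σ ψ
  substF σ (φ ∨ᶠ ψ)  = substF σ φ ∨ᶠ substF σ ψ
  substF σ (φ →ᶠ ψ)  = substF σ φ →ᶠ substF σ ψ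
  substF σ (∀ᶠ φ)    = ∀ᶠ (substF (lift σ) φ)
  substF σ (∃ᶠ φ)    = ∃ᶠ (substF (lift σ) φ)

  -- shifting all free variables up by one (used to express "x not free in …")
  shift : Fm → Fm
  shift = substF wkSub

  inst : Fm → Tm → Fm
  inst φ t = substF σ φ
    where
      σ : Sub
      σ zero    = t
      σ (suc n) = var n

  -- bound on free variables: all free indices are < fvF φ
  mutual
    fvT : Tm → ℕ
    fvT (var n)   = suc n
    fvT (fn f ts) = fvTs ts

    fvTs : List Tm → ℕ
    fvTs []       = 0
    fvTs (t ∷ ts) = fvT t ⊔ fvTs ts

  fvF : Fm → ℕ
  fvF (pr p ts) = fvTs ts
  fvF ⊥ᶠ        = 0
  fvF (φ ∧ᶠ ψ)  = fvF φ ⊔ fvF ψ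
  fvF (φ ∨ᶠ ψ)  = fvF φ ⊔ fvF ψ
  fvF (φ →ᶠ ψ)  = fvF φ ⊔ fvF ψ
  fvF (∀ᶠ φ)    = fvF φ ∸ 1
  fvF (∃ᶠ φ)    = fvF φ ∸ 1

  ∀ⁿ : ℕ → Fm → Fm
  ∀ⁿ zero    φ = φ
  ∀ⁿ (suc n) φ = ∀ᶠ (∀ⁿ n φ)

  closure : Fm → Fm
  closure φ = ∀ⁿ (fvF φ) φ

  ⊤ᶠ : Fm
  ⊤ᶠ = ⊥ᶠ →ᶠ ⊥ᶠ

  ⋀ : List Fm → Fm
  ⋀ []           = ⊤ᶠ
  ⋀ (φ ∷ [])     = φ
  ⋀ (φ ∷ ψ ∷ Γ)  = φ ∧ᶠ ⋀ (ψ ∷ Γ)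

  ⋁ : List Fm → Fm
  ⋁ []           = ⊥ᶠ
  ⋁ (φ ∷ [])     = φ
  ⋁ (φ ∷ ψ ∷ Γ)  = φ ∨ᶠ ⋁ (ψ ∷ Γ)

  record Seq : Set where
    constructor _⇒_
    field
      ante : List Fm
      succ : List Fm

  HSeq : Set
  HSeq = List Seq

  shiftL : List Fm → List Fm
  shiftL = map shift

  shiftH : HSeq → HSeq
  shiftH = map (λ S → shiftL (Seq.ante S) ⇒ shiftL (Seq.succ S))

  data ∀HLJ'rs : HSeq → Set where
    ax   : ∀ φ → ∀HLJ'rs ((φ ∷ [] ⇒ φ ∷ []) ∷ [])
    ax⊥  : ∀ φ → ∀HLJ'rs ((⊥ᶠ ∷ [] ⇒ φ ∷ []) ∷ [])
    ew   : ∀ {S G} → ∀HLJ'rs G → ∀HLJ'rs (S ∷ G)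
    ec   : ∀ {S G} → ∀HLJ'rs (S ∷ S ∷ G) → ∀HLJ'rs (S ∷ G)
    ee   : ∀ {G S T H} → ∀HLJ'rs (G ++ S ∷ T ∷ H) → ∀HLJ'rs (G ++ T ∷ S ∷ H)
    iwl  : ∀ {φ Γ Δ G} → ∀HLJ'rs ((Γ ⇒ Δ) ∷ G) → ∀HLJ'rs ((φ ∷ Γ ⇒ Δ) ∷ G)
    iwr  : ∀ {φ Γ Δ G} → ∀HLJ'rs ((Γ ⇒ Δ) ∷ G) → ∀HLJ'rs ((Γ ⇒ Δ ∷ʳ φ) ∷ G)
    icl  : ∀ {φ Γ Δ G} → ∀HLJ'rs ((φ ∷ φ ∷ Γ ⇒ Δ) ∷ G) → ∀HLJ'rs ((φ ∷ Γ ⇒ Δ) ∷ G)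
    icr  : ∀ {φ Γ Δ G} → ∀HLJ'rs ((Γ ⇒ Δ ∷ʳ φ ∷ʳ φ) ∷ G) → ∀HLJ'rs ((Γ ⇒ Δ ∷ʳ φ) ∷ G)
    iel  : ∀ {φ ψ Γ₁ Γ₂ Δ G} → ∀HLJ'rs ((Γ₁ ++ φ ∷ ψ ∷ Γ₂ ⇒ Δ) ∷ G)
                             → ∀HLJ'rs ((Γ₁ ++ ψ ∷ φ ∷ Γ₂ ⇒ Δ) ∷ G)
    ier  : ∀ {φ ψ Γ Δ₁ Δ₂ G} → ∀HLJ'rs ((Γ ⇒ Δ₁ ++ φ ∷ ψ ∷ Δ₂) ∷ G)
                             → ∀HLJ'rs ((Γ ⇒ Δ₁ ++ ψ ∷ φ ∷ Δ₂) ∷ G)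
    cut  : ∀ {δ Γ₀ Δ₀ Γ₁ Δ₁ G} → ∀HLJ'rs ((Γ₀ ⇒ Δ₀ ∷ʳ δ) ∷ G) → ∀HLJ'rs ((δ ∷ Γ₁ ⇒ Δ₁) ∷ G)
                               → ∀HLJ'rs ((Γ₀ ++ Γ₁ ⇒ Δ₀ ++ Δ₁) ∷ G)
    →l   : ∀ {φ ψ Γ Δ G} → ∀HLJ'rs ((Γ ⇒ Δ ∷ʳ φ) ∷ G) → ∀HLJ'rs ((ψ ∷ Γ ⇒ Δ) ∷ G)
                         → ∀HLJ'rs (((φ →ᶠ ψ) ∷ Γ ⇒ Δ) ∷ G)
    →r   : ∀ {φ ψ Γ G} → ∀HLJ'rs ((φ ∷ Γ ⇒ ψ ∷ []) ∷ G) → ∀HLJ'rs ((Γ ⇒ (φ →ᶠ ψ) ∷ []) ∷ G)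
    ∨l   : ∀ {φ₁ φ₂ Γ Δ G} → ∀HLJ'rs ((φ₁ ∷ Γ ⇒ Δ) ∷ G) → ∀HLJ'rs ((φ₂ ∷ Γ ⇒ Δ) ∷ G)
                           → ∀HLJ'rs (((φ₁ ∨ᶠ φ₂) ∷ Γ ⇒ Δ) ∷ G)
    ∨r₁  : ∀ {φ₁ φ₂ Γ Δ G} → ∀HLJ'rs ((Γ ⇒ Δ ∷ʳ φ₁) ∷ G) → ∀HLJ'rs ((Γ ⇒ Δ ∷ʳ (φ₁ ∨ᶠ φ₂)) ∷ G)
    ∨r₂  : ∀ {φ₁ φ₂ Γ Δ G} → ∀HLJ'rs ((Γ ⇒ Δ ∷ʳ φ₂) ∷ G) → ∀HLJ'rs ((Γ ⇒ Δ ∷ʳ (φ₁ ∨ᶠ φ₂)) ∷ G)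
    ∧l₁  : ∀ {φ₁ φ₂ Γ Δ G} → ∀HLJ'rs ((φ₁ ∷ Γ ⇒ Δ) ∷ G) → ∀HLJ'rs (((φ₁ ∧ᶠ φ₂) ∷ Γ ⇒ Δ) ∷ G)
    ∧l₂  : ∀ {φ₁ φ₂ Γ Δ G} → ∀HLJ'rs ((φ₂ ∷ Γ ⇒ Δ) ∷ G) → ∀HLJ'rs (((φ₁ ∧ᶠ φ₂) ∷ Γ ⇒ Δ) ∷ G)
    ∧r   : ∀ {φ₁ φ₂ Γ Δ G} → ∀HLJ'rs ((Γ ⇒ Δ ∷ʳ φ₁) ∷ G) → ∀HLJ'rs ((Γ ⇒ Δ ∷ʳ φ₂) ∷ G)
                           → ∀HLJ'rs ((Γ ⇒ Δ ∷ʳ (φ₁ ∧ᶠ φ₂)) ∷ G)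
    ∀l   : ∀ {φ t Γ Δ G} → ∀HLJ'rs ((inst φ t ∷ Γ ⇒ Δ) ∷ G) → ∀HLJ'rs ((∀ᶠ φ ∷ Γ ⇒ Δ) ∷ G)
    ∀r   : ∀ {φ Γ} → ∀HLJ'rs ((shiftL Γ ⇒ φ ∷ []) ∷ []) → ∀HLJ'rs ((Γ ⇒ ∀ᶠ φ ∷ []) ∷ [])
    ∃l   : ∀ {φ Γ Δ} → ∀HLJ'rs ((φ ∷ shiftL Γ ⇒ shiftL Δ) ∷ []) → ∀HLJ'rs ((∃ᶠ φ ∷ Γ ⇒ Δ) ∷ [])
    ∃r   : ∀ {ψ t Γ Δ G} → ∀HLJ'rs ((Γ ⇒ Δ ∷ʳ inst ψ t) ∷ G) → ∀HLJ'rs ((Γ ⇒ Δ ∷ʳ ∃ᶠ ψ) ∷ G)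
    -- (∀-R_ms): x not free in the conclusion Γ ⇒ ∀xφ | G
    ∀rms : ∀ {φ Γ G} → ∀HLJ'rs ((shiftL Γ ⇒ φ ∷ []) ∷ shiftH G) → ∀HLJ'rs ((Γ ⇒ ∀ᶠ φ ∷ []) ∷ G)
    rs   : ∀ {Γ Δ₁ Δ₂ G} → ∀HLJ'rs ((Γ ⇒ Δ₁ ++ Δ₂) ∷ G) → ∀HLJ'rs ((Γ ⇒ Δ₁) ∷ (Γ ⇒ Δ₂) ∷ G)

  data ∀GD⊢ : Fm → Set where
    k    : ∀ {φ ψ} → ∀GD⊢ (φ →ᶠ ψ →ᶠ φ)
    s    : ∀ {φ ψ χ} → ∀GD⊢ ((φ →ᶠ ψ →ᶠ χ) →ᶠ (φ →ᶠ ψ) →ᶠ φ →ᶠ χ)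
    ∧e₁  : ∀ {φ ψ} → ∀GD⊢ (φ ∧ᶠ ψ →ᶠ φ)
    ∧e₂  : ∀ {φ ψ} → ∀GD⊢ (φ ∧ᶠ ψ →ᶠ ψ)
    ∧i   : ∀ {φ ψ} → ∀GD⊢ (φ →ᶠ ψ →ᶠ φ ∧ᶠ ψ)
    ∨i₁  : ∀ {φ ψ} → ∀GD⊢ (φ →ᶠ φ ∨ᶠ ψ)
    ∨i₂  : ∀ {φ ψ} → ∀GD⊢ (ψ →ᶠ φ ∨ᶠ ψ)
    ∨e   : ∀ {φ ψ χ} → ∀GD⊢ ((φ →ᶠ χ) →ᶠ (ψ →ᶠ χ) →ᶠ φ ∨ᶠ ψ →ᶠ χ)
    efq  : ∀ {φ} → ∀GD⊢ (⊥ᶠ →ᶠ φ)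
    ∀e   : ∀ {φ t} → ∀GD⊢ (∀ᶠ φ →ᶠ inst φ t)
    ∃i   : ∀ {φ t} → ∀GD⊢ (inst φ t →ᶠ ∃ᶠ φ)
    ∀gen : ∀ {ψ φ} → ∀GD⊢ (shift ψ →ᶠ φ) → ∀GD⊢ (ψ →ᶠ ∀ᶠ φ)
    ∃gen : ∀ {φ ψ} → ∀GD⊢ (φ →ᶠ shift ψ) → ∀GD⊢ (∃ᶠ φ →ᶠ ψ)
    lin  : ∀ {φ ψ} → ∀GD⊢ ((φ →ᶠ ψ) ∨ᶠ (ψ →ᶠ φ))
    acd  : ∀ {φ ψ} → ∀GD⊢ (∀ᶠ (shift φ ∨ᶠ ψ) →ᶠ φ ∨ᶠ ∀ᶠ ψ)
    mp   : ∀ {φ ψ} → ∀GD⊢ (φ →ᶠ ψ) → ∀GD⊢ φ → ∀GD⊢ ψ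

  seqFm : Seq → Fm
  seqFm (Γ ⇒ Δ) = ⋀ Γ →ᶠ ⋁ Δ

  hseqFm : HSeq → Fm
  hseqFm H = ⋁ (map seqFm H)

-- A hypersequent is read as the disjunction of its components, a component Γ ⇒ Δ as
-- ⋀ Γ → ⋁ Δ. Every rule acts on one component and leaves the side hypersequent G
-- untouched, so soundness reduces to deriving the conclusion component from the premise
-- components and reasoning by cases inside the disjunction with G; for this a deduction
-- theorem for the Hilbert systems is proved once. Only two rules need more than
-- intuitionistic logic. (rs) needs (A → B ∨ C) → (A → B) ∨ (A → C), obtained from
-- linearity by cases on (B → C) ∨ (C → B). (∀-R_ms) needs ACD: its premise gives
-- ∀x (G ∨ (Γ → φ)) with x not free in G and Γ, hence G ∨ ∀x (Γ → φ), hence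
-- G ∨ (Γ → ∀x φ). The universal closure then follows by generalisation.
module Submission where

open import Defs

open import Data.Nat using (zero; suc)
open import Data.Product using (_×_; _,_)
open import Data.List using (List; []; _∷_; _++_; [_]; _∷ʳ_; map)
open import Data.List.Properties using (map-++)
open import Data.List.Membership.Propositional using (_∈_)
open import Data.List.Relation.Unary.Any using (here; there)
open import Function using (_∘_; id)
open import Relation.Binary.PropositionalEquality
  using (_≡_; _≗_; refl; sym; trans; subst; cong; cong₂; module ≡-Reasoning)

record GödelDummettHilbert : Set₁ where
  infixr 4 _⊃_
  infixr 5 _∨_
  infixr 6 _∧_
  infix 2 ⊢_
  field
    Fm          : Set
    ⊥           : Fm
    _∧_ _∨_ _⊃_ : Fm → Fm → Fm
    ⊢_          : Fm → Set
    k    : ∀ {A B} → ⊢ A ⊃ B ⊃ A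
    s    : ∀ {A B C} → ⊢ (A ⊃ B ⊃ C) ⊃ (A ⊃ B) ⊃ A ⊃ C
    ∧e₁  : ∀ {A B} → ⊢ A ∧ B ⊃ A
    ∧e₂  : ∀ {A B} → ⊢ A ∧ B ⊃ B
    ∧i   : ∀ {A B} → ⊢ A ⊃ B ⊃ A ∧ B
    ∨i₁  : ∀ {A B} → ⊢ A ⊃ A ∨ B
    ∨i₂  : ∀ {A B} → ⊢ B ⊃ A ∨ B
    ∨e   : ∀ {A B C} → ⊢ (A ⊃ C) ⊃ (B ⊃ C) ⊃ A ∨ B ⊃ C
    efq  : ∀ {A} → ⊢ ⊥ ⊃ A
    lin  : ∀ {A B} → ⊢ (A ⊃ B) ∨ (B ⊃ A)
    mp   : ∀ {A B} → ⊢ A ⊃ B → ⊢ A → ⊢ B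

module Deduction (L : GödelDummettHilbert) where
  open GödelDummettHilbert L

  infix 2 _⊩_

  data _⊩_ (Γ : List Fm) : Fm → Set where
    axiom : ∀ {A} → ⊢ A → Γ ⊩ A
    hyp   : ∀ {A} → A ∈ Γ → Γ ⊩ A
    app   : ∀ {A B} → Γ ⊩ A ⊃ B → Γ ⊩ A → Γ ⊩ B

  ⊃-refl : ∀ {A} → ⊢ A ⊃ A
  ⊃-refl {A} = mp (mp s (k {A} {A ⊃ A})) k

  lam : ∀ {Γ A B} → A ∷ Γ ⊩ B → Γ ⊩ A ⊃ B
  lam (axiom p)         = axiom (mp k p)
  lam (hyp (here refl)) = axiom ⊃-refl
  lam (hyp (there x))   = app (axiom k) (hyp x)
  lam (app f x)         = app (app (axiom s) (lam f)) (lam x)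

  closed : ∀ {A} → [] ⊩ A → ⊢ A
  closed (axiom p) = p
  closed (app f x) = mp (closed f) (closed x)

  ⊢⊃ : ∀ {A B} → [ A ] ⊩ B → ⊢ A ⊃ B
  ⊢⊃ d = closed (lam d)

  weaken : ∀ {Γ A B} → Γ ⊩ A → B ∷ Γ ⊩ A
  weaken (axiom p) = axiom p
  weaken (hyp x)   = hyp (there x)
  weaken (app f x) = app (weaken f) (weaken x)

  #0 : ∀ {Γ A} → A ∷ Γ ⊩ A
  #0 = hyp (here refl)

  #1 : ∀ {Γ A B} → B ∷ A ∷ Γ ⊩ A
  #1 = weaken #0

  #2 : ∀ {Γ A B C} → C ∷ B ∷ A ∷ Γ ⊩ A
  #2 = weaken #1

  #3 : ∀ {Γ A B C D} → D ∷ C ∷ B ∷ A ∷ Γ ⊩ A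
  #3 = weaken #2

  module _ {Γ : List Fm} where

    use : ∀ {A B} → ⊢ A ⊃ B → Γ ⊩ A → Γ ⊩ B
    use p = app (axiom p)

    pair : ∀ {A B} → Γ ⊩ A → Γ ⊩ B → Γ ⊩ A ∧ B
    pair a b = app (use ∧i a) b

    fst : ∀ {A B} → Γ ⊩ A ∧ B → Γ ⊩ A
    fst = use ∧e₁

    snd : ∀ {A B} → Γ ⊩ A ∧ B → Γ ⊩ B
    snd = use ∧e₂

    inl : ∀ {A B} → Γ ⊩ A → Γ ⊩ A ∨ B
    inl = use ∨i₁

    inr : ∀ {A B} → Γ ⊩ B → Γ ⊩ A ∨ B
    inr = use ∨i₂

    case : ∀ {A B C} → Γ ⊩ A ∨ B → A ∷ Γ ⊩ C → B ∷ Γ ⊩ C → Γ ⊩ C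
    case d l r = app (app (use ∨e (lam l)) (lam r)) d

    abort : ∀ {A} → Γ ⊩ ⊥ → Γ ⊩ A
    abort = use efq

  ≡⇒⊃ : ∀ {A B} → A ≡ B → ⊢ A ⊃ B
  ≡⇒⊃ refl = ⊃-refl

  ⊃-distribˡ-∨ : ∀ {A B C} → ⊢ (A ⊃ B ∨ C) ⊃ (A ⊃ B) ∨ (A ⊃ C)
  ⊃-distribˡ-∨ = ⊢⊃ (case (axiom lin)
    (inr (lam (case (app #2 #0) (app #2 #0) #0)))
    (inl (lam (case (app #2 #0) #0 (app #2 #0)))))

record SequentInterpretation (L : GödelDummettHilbert) : Set₁ where
  open GödelDummettHilbert L
  infix 3 _⇒_
  field
    ⋀ ⋁         : List Fm → Fm
    ⋀-[]        : ⋀ [] ≡ (⊥ ⊃ ⊥)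
    ⋀-singleton : ∀ A → ⋀ [ A ] ≡ A
    ⋀-∷         : ∀ A B Γ → ⋀ (A ∷ B ∷ Γ) ≡ (A ∧ ⋀ (B ∷ Γ))
    ⋁-[]        : ⋁ [] ≡ ⊥
    ⋁-singleton : ∀ A → ⋁ [ A ] ≡ A
    ⋁-∷         : ∀ A B Δ → ⋁ (A ∷ B ∷ Δ) ≡ (A ∨ ⋁ (B ∷ Δ))
    Seq         : Set
    _⇒_         : List Fm → List Fm → Seq
    seqFm       : Seq → Fm
    seqFm-⇒     : ∀ Γ Δ → seqFm (Γ ⇒ Δ) ≡ (⋀ Γ ⊃ ⋁ Δ)

module Hypersequents {L : GödelDummettHilbert} (I : SequentInterpretation L) where

  open GödelDummettHilbert L
  open SequentInterpretation I
  open Deduction L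

  ⋀-[]⁺ : ⊢ ⋀ []
  ⋀-[]⁺ = mp (≡⇒⊃ (sym ⋀-[])) ⊃-refl

  ⋀-uncons : ∀ {A Γ} → ⊢ ⋀ (A ∷ Γ) ⊃ A ∧ ⋀ Γ
  ⋀-uncons {A} {[]}    = ⊢⊃ (pair (use (≡⇒⊃ (⋀-singleton A)) #0) (axiom ⋀-[]⁺))
  ⋀-uncons {A} {B ∷ Γ} = ≡⇒⊃ (⋀-∷ A B Γ)

  ⋀-cons : ∀ {A Γ} → ⊢ A ∧ ⋀ Γ ⊃ ⋀ (A ∷ Γ)
  ⋀-cons {A} {[]}    = ⊢⊃ (use (≡⇒⊃ (sym (⋀-singleton A))) (fst #0))
  ⋀-cons {A} {B ∷ Γ} = ≡⇒⊃ (sym (⋀-∷ A B Γ))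

  ⋁-[]⁻ : ⊢ ⋁ [] ⊃ ⊥
  ⋁-[]⁻ = ≡⇒⊃ ⋁-[]

  ⋁-uncons : ∀ {A Δ} → ⊢ ⋁ (A ∷ Δ) ⊃ A ∨ ⋁ Δ
  ⋁-uncons {A} {[]}    = ⊢⊃ (inl (use (≡⇒⊃ (⋁-singleton A)) #0))
  ⋁-uncons {A} {B ∷ Δ} = ≡⇒⊃ (⋁-∷ A B Δ)

  ⋁-cons : ∀ {A Δ} → ⊢ A ∨ ⋁ Δ ⊃ ⋁ (A ∷ Δ)
  ⋁-cons {A} {[]}    = ⊢⊃ (use (≡⇒⊃ (sym (⋁-singleton A))) (case #0 #0 (abort (use ⋁-[]⁻ #0))))
  ⋁-cons {A} {B ∷ Δ} = ≡⇒⊃ (sym (⋁-∷ A B Δ))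

  ⋀-++⁻ : ∀ Γ Γ′ → ⊢ ⋀ (Γ ++ Γ′) ⊃ ⋀ Γ ∧ ⋀ Γ′
  ⋀-++⁻ []      Γ′ = ⊢⊃ (pair (axiom ⋀-[]⁺) #0)
  ⋀-++⁻ (A ∷ Γ) Γ′ = ⊢⊃
    (let x = use ⋀-uncons #0 ; y = use (⋀-++⁻ Γ Γ′) (snd x)
     in pair (use ⋀-cons (pair (fst x) (fst y))) (snd y))

  ⋀-swap : ∀ Γ₁ {A B Γ₂} → ⊢ ⋀ (Γ₁ ++ A ∷ B ∷ Γ₂) ⊃ ⋀ (Γ₁ ++ B ∷ A ∷ Γ₂)
  ⋀-swap [] = ⊢⊃
    (let x = use ⋀-uncons #0 ; y = use ⋀-uncons (snd x)
     in use ⋀-cons (pair (fst y) (use ⋀-cons (pair (fst x) (snd y)))))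
  ⋀-swap (C ∷ Γ₁) = ⊢⊃
    (let x = use ⋀-uncons #0 in use ⋀-cons (pair (fst x) (use (⋀-swap Γ₁) (snd x))))

  ⋁-++⁻ : ∀ Δ Δ′ → ⊢ ⋁ (Δ ++ Δ′) ⊃ ⋁ Δ ∨ ⋁ Δ′
  ⋁-++⁻ []      Δ′ = ⊢⊃ (inr #0)
  ⋁-++⁻ (A ∷ Δ) Δ′ = ⊢⊃ (case (use ⋁-uncons #0)
    (inl (use ⋁-cons (inl #0)))
    (case (use (⋁-++⁻ Δ Δ′) #0) (inl (use ⋁-cons (inr #0))) (inr #0)))

  ⋁-++⁺ : ∀ Δ Δ′ → ⊢ ⋁ Δ ∨ ⋁ Δ′ ⊃ ⋁ (Δ ++ Δ′)
  ⋁-++⁺ []      Δ′ = ⊢⊃ (case #0 (abort (use ⋁-[]⁻ #0)) #0)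
  ⋁-++⁺ (A ∷ Δ) Δ′ = ⊢⊃ (case #0
    (case (use ⋁-uncons #0)
      (use ⋁-cons (inl #0))
      (use ⋁-cons (inr (use (⋁-++⁺ Δ Δ′) (inl #0)))))
    (use ⋁-cons (inr (use (⋁-++⁺ Δ Δ′) (inr #0)))))

  ⋁-∷ʳ⁻ : ∀ Δ {A} → ⊢ ⋁ (Δ ∷ʳ A) ⊃ ⋁ Δ ∨ A
  ⋁-∷ʳ⁻ Δ {A} = ⊢⊃ (case (use (⋁-++⁻ Δ _) #0) (inl #0) (inr (use (≡⇒⊃ (⋁-singleton A)) #0)))

  ⋁-∷ʳ⁺ : ∀ Δ {A} → ⊢ ⋁ Δ ∨ A ⊃ ⋁ (Δ ∷ʳ A)
  ⋁-∷ʳ⁺ Δ {A} = ⊢⊃ (use (⋁-++⁺ Δ _) (case #0 (inl #0) (inr (use (≡⇒⊃ (sym (⋁-singleton A))) #0))))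

  ⋁-swap : ∀ Δ₁ {A B Δ₂} → ⊢ ⋁ (Δ₁ ++ A ∷ B ∷ Δ₂) ⊃ ⋁ (Δ₁ ++ B ∷ A ∷ Δ₂)
  ⋁-swap [] = ⊢⊃ (case (use ⋁-uncons #0)
    (use ⋁-cons (inr (use ⋁-cons (inl #0))))
    (case (use ⋁-uncons #0)
      (use ⋁-cons (inl #0))
      (use ⋁-cons (inr (use ⋁-cons (inr #0))))))
  ⋁-swap (C ∷ Δ₁) = ⊢⊃ (case (use ⋁-uncons #0)
    (use ⋁-cons (inl #0))
    (use ⋁-cons (inr (use (⋁-swap Δ₁) #0))))

  seq : List Fm → List Fm → Fm
  seq Γ Δ = ⋀ Γ ⊃ ⋁ Δ

  ⋁-head-mono : ∀ {S S′ G} → ⊢ S ⊃ S′ → ⊢ ⋁ (S ∷ G) → ⊢ ⋁ (S′ ∷ G)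
  ⋁-head-mono f p = closed (use ⋁-cons (case (use ⋁-uncons (axiom p)) (inl (use f #0)) (inr #0)))

  ⋁-head-mono₂ : ∀ {S₁ S₂ S′ G} → ⊢ S₁ ⊃ S₂ ⊃ S′ → ⊢ ⋁ (S₁ ∷ G) → ⊢ ⋁ (S₂ ∷ G) → ⊢ ⋁ (S′ ∷ G)
  ⋁-head-mono₂ f p q = closed (use ⋁-cons (case (use ⋁-uncons (axiom p))
    (case (use ⋁-uncons (axiom q)) (inl (app (use f #1) #0)) (inr #0))
    (inr #0)))

  -- A record rather than a function, so that unification can read H off the type.
  record Valid (H : List Seq) : Set where
    constructor valid
    field derivable : ⊢ ⋁ (map seqFm H)

  open Valid public

  valid-rule : ∀ {Γ Δ Γ′ Δ′ G} → ⊢ seq Γ Δ ⊃ seq Γ′ Δ′ →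
               Valid ((Γ ⇒ Δ) ∷ G) → Valid ((Γ′ ⇒ Δ′) ∷ G)
  derivable (valid-rule {Γ} {Δ} {Γ′} {Δ′} f (valid p))
    rewrite seqFm-⇒ Γ Δ | seqFm-⇒ Γ′ Δ′ = ⋁-head-mono f p

  valid-rule₂ : ∀ {Γ₁ Δ₁ Γ₂ Δ₂ Γ′ Δ′ G} → ⊢ seq Γ₁ Δ₁ ⊃ seq Γ₂ Δ₂ ⊃ seq Γ′ Δ′ →
                Valid ((Γ₁ ⇒ Δ₁) ∷ G) → Valid ((Γ₂ ⇒ Δ₂) ∷ G) → Valid ((Γ′ ⇒ Δ′) ∷ G)
  derivable (valid-rule₂ {Γ₁} {Δ₁} {Γ₂} {Δ₂} {Γ′} {Δ′} f (valid p) (valid q))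
    rewrite seqFm-⇒ Γ₁ Δ₁ | seqFm-⇒ Γ₂ Δ₂ | seqFm-⇒ Γ′ Δ′ = ⋁-head-mono₂ f p q

  valid-axiom : ∀ {Γ Δ} → ⊢ seq Γ Δ → Valid [ Γ ⇒ Δ ]
  derivable (valid-axiom {Γ} {Δ} p) rewrite seqFm-⇒ Γ Δ = mp (≡⇒⊃ (sym (⋁-singleton _))) p

  valid-ax : ∀ {A} → Valid [ [ A ] ⇒ [ A ] ]
  valid-ax {A} = valid-axiom (≡⇒⊃ (trans (⋀-singleton A) (sym (⋁-singleton A))))

  valid-ax⊥ : ∀ {A} → Valid [ [ ⊥ ] ⇒ [ A ] ]
  valid-ax⊥ = valid-axiom (⊢⊃ (abort (use (≡⇒⊃ (⋀-singleton ⊥)) #0)))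

  valid-ew : ∀ {S G} → Valid G → Valid (S ∷ G)
  valid-ew (valid p) = valid (mp ⋁-cons (mp ∨i₂ p))

  valid-ec : ∀ {S G} → Valid (S ∷ S ∷ G) → Valid (S ∷ G)
  valid-ec (valid p) = valid (closed (case (use ⋁-uncons (axiom p)) (use ⋁-cons (inl #0)) #0))

  -- Lists to the left of _++_ or _∷ʳ_ are explicit arguments: unification cannot invert them.
  valid-ee : ∀ G {S T H} → Valid (G ++ S ∷ T ∷ H) → Valid (G ++ T ∷ S ∷ H)
  valid-ee G {S} {T} {H} (valid p) =
    valid (subst (⊢_ ∘ ⋁) (sym (map-++ seqFm G (T ∷ S ∷ H)))
      (mp (⋁-swap (map seqFm G)) (subst (⊢_ ∘ ⋁) (map-++ seqFm G (S ∷ T ∷ H)) p)))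

  valid-antecedent-mono : ∀ {A B Γ Δ G} → ⊢ B ⊃ A →
                          Valid ((A ∷ Γ ⇒ Δ) ∷ G) → Valid ((B ∷ Γ ⇒ Δ) ∷ G)
  valid-antecedent-mono f = valid-rule (⊢⊃ (lam
    (let x = use ⋀-uncons #0 in app #1 (use ⋀-cons (pair (use f (fst x)) (snd x))))))

  valid-succedent-mono : ∀ Δ {A B Γ G} → ⊢ A ⊃ B →
                         Valid ((Γ ⇒ Δ ∷ʳ A) ∷ G) → Valid ((Γ ⇒ Δ ∷ʳ B) ∷ G)
  valid-succedent-mono Δ f = valid-rule (⊢⊃ (lam (case (use (⋁-∷ʳ⁻ Δ) (app #1 #0))
    (use (⋁-∷ʳ⁺ Δ) (inl #0))
    (use (⋁-∷ʳ⁺ Δ) (inr (use f #0))))))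

  valid-iwl : ∀ {A Γ Δ G} → Valid ((Γ ⇒ Δ) ∷ G) → Valid ((A ∷ Γ ⇒ Δ) ∷ G)
  valid-iwl = valid-rule (⊢⊃ (lam (app #1 (snd (use ⋀-uncons #0)))))

  valid-iwr : ∀ Δ {A Γ G} → Valid ((Γ ⇒ Δ) ∷ G) → Valid ((Γ ⇒ Δ ∷ʳ A) ∷ G)
  valid-iwr Δ = valid-rule (⊢⊃ (lam (use (⋁-∷ʳ⁺ Δ) (inl (app #1 #0)))))

  valid-icl : ∀ {A Γ Δ G} → Valid ((A ∷ A ∷ Γ ⇒ Δ) ∷ G) → Valid ((A ∷ Γ ⇒ Δ) ∷ G)
  valid-icl = valid-rule (⊢⊃ (lam (app #1 (use ⋀-cons (pair (fst (use ⋀-uncons #0)) #0)))))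

  valid-icr : ∀ Δ {A Γ G} → Valid ((Γ ⇒ Δ ∷ʳ A ∷ʳ A) ∷ G) → Valid ((Γ ⇒ Δ ∷ʳ A) ∷ G)
  valid-icr Δ = valid-rule (⊢⊃ (lam (case (use (⋁-∷ʳ⁻ (Δ ∷ʳ _)) (app #1 #0))
    #0
    (use (⋁-∷ʳ⁺ Δ) (inr #0)))))

  valid-iel : ∀ Γ₁ {A B Γ₂ Δ G} →
              Valid ((Γ₁ ++ A ∷ B ∷ Γ₂ ⇒ Δ) ∷ G) → Valid ((Γ₁ ++ B ∷ A ∷ Γ₂ ⇒ Δ) ∷ G)
  valid-iel Γ₁ = valid-rule (⊢⊃ (lam (app #1 (use (⋀-swap Γ₁) #0))))

  valid-ier : ∀ Δ₁ {A B Γ Δ₂ G} →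
              Valid ((Γ ⇒ Δ₁ ++ A ∷ B ∷ Δ₂) ∷ G) → Valid ((Γ ⇒ Δ₁ ++ B ∷ A ∷ Δ₂) ∷ G)
  valid-ier Δ₁ = valid-rule (⊢⊃ (lam (use (⋁-swap Δ₁) (app #1 #0))))

  valid-cut : ∀ Γ₀ Δ₀ {C Γ₁ Δ₁ G} → Valid ((Γ₀ ⇒ Δ₀ ∷ʳ C) ∷ G) → Valid ((C ∷ Γ₁ ⇒ Δ₁) ∷ G) →
              Valid ((Γ₀ ++ Γ₁ ⇒ Δ₀ ++ Δ₁) ∷ G)
  valid-cut Γ₀ Δ₀ {Γ₁ = Γ₁} {Δ₁} = valid-rule₂ (⊢⊃ (lam (lam
    (let γ = use (⋀-++⁻ Γ₀ Γ₁) #0 in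
     case (use (⋁-∷ʳ⁻ Δ₀) (app #2 (fst γ)))
       (use (⋁-++⁺ Δ₀ Δ₁) (inl #0))
       (use (⋁-++⁺ Δ₀ Δ₁) (inr (app #2 (use ⋀-cons (pair #0 (snd (weaken γ)))))))))))

  valid-→l : ∀ Δ {A B Γ G} → Valid ((Γ ⇒ Δ ∷ʳ A) ∷ G) → Valid ((B ∷ Γ ⇒ Δ) ∷ G) →
             Valid (((A ⊃ B) ∷ Γ ⇒ Δ) ∷ G)
  valid-→l Δ = valid-rule₂ (⊢⊃ (lam (lam
    (let x = use ⋀-uncons #0 in
     case (use (⋁-∷ʳ⁻ Δ) (app #2 (snd x)))
       #0
       (app #2 (use ⋀-cons (pair (app (fst (weaken x)) #0) (snd (weaken x)))))))))

  valid-→r : ∀ {A B Γ G} → Valid ((A ∷ Γ ⇒ [ B ]) ∷ G) → Valid ((Γ ⇒ [ A ⊃ B ]) ∷ G)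
  valid-→r {A} {B} = valid-rule (⊢⊃ (lam (use (≡⇒⊃ (sym (⋁-singleton (A ⊃ B))))
    (lam (use (≡⇒⊃ (⋁-singleton B)) (app #2 (use ⋀-cons (pair #0 #1))))))))

  valid-∨l : ∀ {A B Γ Δ G} → Valid ((A ∷ Γ ⇒ Δ) ∷ G) → Valid ((B ∷ Γ ⇒ Δ) ∷ G) →
             Valid (((A ∨ B) ∷ Γ ⇒ Δ) ∷ G)
  valid-∨l = valid-rule₂ (⊢⊃ (lam (lam
    (let x = use ⋀-uncons #0 in
     case (fst x)
       (app #3 (use ⋀-cons (pair #0 (snd (weaken x)))))
       (app #2 (use ⋀-cons (pair #0 (snd (weaken x)))))))))

  valid-∨r₁ : ∀ Δ {A B Γ G} → Valid ((Γ ⇒ Δ ∷ʳ A) ∷ G) → Valid ((Γ ⇒ Δ ∷ʳ (A ∨ B)) ∷ G)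
  valid-∨r₁ Δ = valid-succedent-mono Δ ∨i₁

  valid-∨r₂ : ∀ Δ {A B Γ G} → Valid ((Γ ⇒ Δ ∷ʳ B) ∷ G) → Valid ((Γ ⇒ Δ ∷ʳ (A ∨ B)) ∷ G)
  valid-∨r₂ Δ = valid-succedent-mono Δ ∨i₂

  valid-∧l₁ : ∀ {A B Γ Δ G} → Valid ((A ∷ Γ ⇒ Δ) ∷ G) → Valid (((A ∧ B) ∷ Γ ⇒ Δ) ∷ G)
  valid-∧l₁ = valid-antecedent-mono ∧e₁

  valid-∧l₂ : ∀ {A B Γ Δ G} → Valid ((B ∷ Γ ⇒ Δ) ∷ G) → Valid (((A ∧ B) ∷ Γ ⇒ Δ) ∷ G)
  valid-∧l₂ = valid-antecedent-mono ∧e₂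

  valid-∧r : ∀ Δ {A B Γ G} → Valid ((Γ ⇒ Δ ∷ʳ A) ∷ G) → Valid ((Γ ⇒ Δ ∷ʳ B) ∷ G) →
             Valid ((Γ ⇒ Δ ∷ʳ (A ∧ B)) ∷ G)
  valid-∧r Δ = valid-rule₂ (⊢⊃ (lam (lam
    (case (use (⋁-∷ʳ⁻ Δ) (app #2 #0))
      (use (⋁-∷ʳ⁺ Δ) (inl #0))
      (case (use (⋁-∷ʳ⁻ Δ) (app #2 #1))
        (use (⋁-∷ʳ⁺ Δ) (inl #0))
        (use (⋁-∷ʳ⁺ Δ) (inr (pair #1 #0))))))))

  valid-rs : ∀ Δ₁ {Δ₂ Γ G} → Valid ((Γ ⇒ Δ₁ ++ Δ₂) ∷ G) → Valid ((Γ ⇒ Δ₁) ∷ (Γ ⇒ Δ₂) ∷ G)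
  derivable (valid-rs Δ₁ {Δ₂} {Γ} (valid p))
    rewrite seqFm-⇒ Γ (Δ₁ ++ Δ₂) | seqFm-⇒ Γ Δ₁ | seqFm-⇒ Γ Δ₂ =
    closed (case (use ⋁-uncons (axiom p))
      (case (use ⊃-distribˡ-∨ (lam (use (⋁-++⁻ Δ₁ Δ₂) (app #1 #0))))
        (use ⋁-cons (inl #0))
        (use ⋁-cons (inr (use ⋁-cons (inl #0)))))
      (use ⋁-cons (inr (use ⋁-cons (inr #0)))))

module PropositionalSoundness where

  open Prop

  GD : GödelDummettHilbert
  GD = record
    { Fm = Fm ; ⊥ = ⊥ᶠ ; _∧_ = _∧ᶠ_ ; _∨_ = _∨ᶠ_ ; _⊃_ = _→ᶠ_ ; ⊢_ = GD⊢
    ; k = GD⊢.k ; s = GD⊢.s ; ∧e₁ = GD⊢.∧e₁ ; ∧e₂ = GD⊢.∧e₂ ; ∧i = GD⊢.∧i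
    ; ∨i₁ = GD⊢.∨i₁ ; ∨i₂ = GD⊢.∨i₂ ; ∨e = GD⊢.∨e ; efq = GD⊢.efq ; lin = GD⊢.lin
    ; mp = GD⊢.mp
    }

  interpretation : SequentInterpretation GD
  interpretation = record
    { ⋀ = ⋀ ; ⋁ = ⋁
    ; ⋀-[] = refl ; ⋀-singleton = λ _ → refl ; ⋀-∷ = λ _ _ _ → refl
    ; ⋁-[] = refl ; ⋁-singleton = λ _ → refl ; ⋁-∷ = λ _ _ _ → refl
    ; Seq = Seq ; _⇒_ = _⇒_ ; seqFm = seqFm ; seqFm-⇒ = λ _ _ → refl
    }

  open Hypersequents interpretation

  sound : ∀ {H} → HLJ'rs H → Valid H
  sound (ax _)                    = valid-ax
  sound (ax⊥ _)                   = valid-ax⊥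
  sound (ew d)                    = valid-ew (sound d)
  sound (ec d)                    = valid-ec (sound d)
  sound (ee {G} d)                = valid-ee G (sound d)
  sound (iwl d)                   = valid-iwl (sound d)
  sound (iwr {Δ = Δ} d)           = valid-iwr Δ (sound d)
  sound (icl d)                   = valid-icl (sound d)
  sound (icr {Δ = Δ} d)           = valid-icr Δ (sound d)
  sound (iel {Γ₁ = Γ₁} d)         = valid-iel Γ₁ (sound d)
  sound (ier {Δ₁ = Δ₁} d)         = valid-ier Δ₁ (sound d)
  sound (cut {Γ₀ = Γ₀} {Δ₀} d e)  = valid-cut Γ₀ Δ₀ (sound d) (sound e)
  sound (→l {Δ = Δ} d e)          = valid-→l Δ (sound d) (sound e)
  sound (→r d)                    = valid-→r (sound d)
  sound (∨l d e)                  = valid-∨l (sound d) (sound e)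
  sound (∨r₁ {Δ = Δ} d)           = valid-∨r₁ Δ (sound d)
  sound (∨r₂ {Δ = Δ} d)           = valid-∨r₂ Δ (sound d)
  sound (∧l₁ d)                   = valid-∧l₁ (sound d)
  sound (∧l₂ d)                   = valid-∧l₂ (sound d)
  sound (∧r {Δ = Δ} d e)          = valid-∧r Δ (sound d) (sound e)
  sound (rs {Δ₁ = Δ₁} d)          = valid-rs Δ₁ (sound d)

  soundness : ∀ {H} → HLJ'rs H → GD⊢ (hseqFm H)
  soundness = derivable ∘ sound

module PredicateSoundness where

  open Pred

  ∀GD : GödelDummettHilbert
  ∀GD = record
    { Fm = Fm ; ⊥ = ⊥ᶠ ; _∧_ = _∧ᶠ_ ; _∨_ = _∨ᶠ_ ; _⊃_ = _→ᶠ_ ; ⊢_ = ∀GD⊢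
    ; k = ∀GD⊢.k ; s = ∀GD⊢.s ; ∧e₁ = ∀GD⊢.∧e₁ ; ∧e₂ = ∀GD⊢.∧e₂ ; ∧i = ∀GD⊢.∧i
    ; ∨i₁ = ∀GD⊢.∨i₁ ; ∨i₂ = ∀GD⊢.∨i₂ ; ∨e = ∀GD⊢.∨e ; efq = ∀GD⊢.efq ; lin = ∀GD⊢.lin
    ; mp = ∀GD⊢.mp
    }

  interpretation : SequentInterpretation ∀GD
  interpretation = record
    { ⋀ = ⋀ ; ⋁ = ⋁
    ; ⋀-[] = refl ; ⋀-singleton = λ _ → refl ; ⋀-∷ = λ _ _ _ → refl
    ; ⋁-[] = refl ; ⋁-singleton = λ _ → refl ; ⋁-∷ = λ _ _ _ → refl
    ; Seq = Seq ; _⇒_ = _⇒_ ; seqFm = seqFm ; seqFm-⇒ = λ _ _ → refl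
    }

  open Deduction ∀GD
  open Hypersequents interpretation
  open ≡-Reasoning

  mutual
    substT-comp : ∀ {σ τ ρ} → substT σ ∘ τ ≗ ρ → substT σ ∘ substT τ ≗ substT ρ
    substT-comp eq (var n)   = eq n
    substT-comp eq (fn f ts) = cong (fn f) (substTs-comp eq ts)

    substTs-comp : ∀ {σ τ ρ} → substT σ ∘ τ ≗ ρ → substTs σ ∘ substTs τ ≗ substTs ρ
    substTs-comp eq []       = refl
    substTs-comp eq (t ∷ ts) = cong₂ _∷_ (substT-comp eq t) (substTs-comp eq ts)

  lift-comp : ∀ {σ τ ρ} → substT σ ∘ τ ≗ ρ → substT (lift σ) ∘ lift τ ≗ lift ρ
  lift-comp eq zero = refl
  lift-comp {σ} {τ} {ρ} eq (suc n) = begin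
    substT (lift σ) (substT wkSub (τ n))  ≡⟨ substT-comp (λ _ → refl) (τ n) ⟩
    substT (substT wkSub ∘ σ) (τ n)       ≡⟨ substT-comp (λ _ → refl) (τ n) ⟨
    substT wkSub (substT σ (τ n))         ≡⟨ cong (substT wkSub) (eq n) ⟩
    lift ρ (suc n)                        ∎

  substF-comp : ∀ {σ τ ρ} → substT σ ∘ τ ≗ ρ → substF σ ∘ substF τ ≗ substF ρ
  substF-comp eq (pr p ts) = cong (pr p) (substTs-comp eq ts)
  substF-comp eq ⊥ᶠ        = refl
  substF-comp eq (A ∧ᶠ B)  = cong₂ _∧ᶠ_ (substF-comp eq A) (substF-comp eq B)
  substF-comp eq (A ∨ᶠ B)  = cong₂ _∨ᶠ_ (substF-comp eq A) (substF-comp eq B)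
  substF-comp eq (A →ᶠ B)  = cong₂ _→ᶠ_ (substF-comp eq A) (substF-comp eq B)
  substF-comp eq (∀ᶠ A)    = cong ∀ᶠ (substF-comp (lift-comp eq) A)
  substF-comp eq (∃ᶠ A)    = cong ∃ᶠ (substF-comp (lift-comp eq) A)

  mutual
    substT-id : ∀ {σ} → σ ≗ var → substT σ ≗ id
    substT-id eq (var n)   = eq n
    substT-id eq (fn f ts) = cong (fn f) (substTs-id eq ts)

    substTs-id : ∀ {σ} → σ ≗ var → substTs σ ≗ id
    substTs-id eq []       = refl
    substTs-id eq (t ∷ ts) = cong₂ _∷_ (substT-id eq t) (substTs-id eq ts)

  lift-id : ∀ {σ} → σ ≗ var → lift σ ≗ var
  lift-id eq zero    = refl
  lift-id eq (suc n) = cong (substT wkSub) (eq n)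

  substF-id : ∀ {σ} → σ ≗ var → substF σ ≗ id
  substF-id eq (pr p ts) = cong (pr p) (substTs-id eq ts)
  substF-id eq ⊥ᶠ        = refl
  substF-id eq (A ∧ᶠ B)  = cong₂ _∧ᶠ_ (substF-id eq A) (substF-id eq B)
  substF-id eq (A ∨ᶠ B)  = cong₂ _∨ᶠ_ (substF-id eq A) (substF-id eq B)
  substF-id eq (A →ᶠ B)  = cong₂ _→ᶠ_ (substF-id eq A) (substF-id eq B)
  substF-id eq (∀ᶠ A)    = cong ∀ᶠ (substF-id (lift-id eq) A)
  substF-id eq (∃ᶠ A)    = cong ∃ᶠ (substF-id (lift-id eq) A)

  inst-var0-lift-wk : ∀ A → inst (substF (lift wkSub) A) (var zero) ≡ A
  inst-var0-lift-wk A = trans (substF-comp (λ { zero → refl ; (suc _) → refl }) A)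
                              (substF-id (λ _ → refl) A)

  shift-⋀ : ∀ Γ → shift (⋀ Γ) ≡ ⋀ (shiftL Γ)
  shift-⋀ []          = refl
  shift-⋀ (A ∷ [])    = refl
  shift-⋀ (A ∷ B ∷ Γ) = cong (shift A ∧ᶠ_) (shift-⋀ (B ∷ Γ))

  shift-⋁ : ∀ Δ → shift (⋁ Δ) ≡ ⋁ (shiftL Δ)
  shift-⋁ []          = refl
  shift-⋁ (A ∷ [])    = refl
  shift-⋁ (A ∷ B ∷ Δ) = cong (shift A ∨ᶠ_) (shift-⋁ (B ∷ Δ))

  hseqFm-shiftH : ∀ G → hseqFm (shiftH G) ≡ shift (hseqFm G)
  hseqFm-shiftH G = trans (cong ⋁ (map-seqFm-shiftH G)) (sym (shift-⋁ (map seqFm G)))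
    where
      map-seqFm-shiftH : ∀ G → map seqFm (shiftH G) ≡ shiftL (map seqFm G)
      map-seqFm-shiftH []            = refl
      map-seqFm-shiftH ((Γ ⇒ Δ) ∷ G) =
        cong₂ _∷_ (cong₂ _→ᶠ_ (sym (shift-⋀ Γ)) (sym (shift-⋁ Δ))) (map-seqFm-shiftH G)

  ∀-elim-shift : ∀ A → ∀GD⊢ (shift (∀ᶠ A) →ᶠ A)
  ∀-elim-shift A = subst (λ B → ∀GD⊢ (shift (∀ᶠ A) →ᶠ B)) (inst-var0-lift-wk A) ∀e

  ∀-intro : ∀ {A} → ∀GD⊢ A → ∀GD⊢ (∀ᶠ A)
  ∀-intro p = mp (∀gen {⊤ᶠ} (mp k p)) ⊃-refl

  ∀ⁿ-intro : ∀ n {A} → ∀GD⊢ A → ∀GD⊢ (∀ⁿ n A)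
  ∀ⁿ-intro zero    p = p
  ∀ⁿ-intro (suc n) p = ∀-intro (∀ⁿ-intro n p)

  ∀-⊃-distrib : ∀ {A B} → ∀GD⊢ (∀ᶠ (shift A →ᶠ B) →ᶠ A →ᶠ ∀ᶠ B)
  ∀-⊃-distrib {A} {B} = ⊢⊃ (lam (app (axiom conj) (pair #1 #0)))
    where
      conj : ∀GD⊢ (∀ᶠ (shift A →ᶠ B) ∧ᶠ A →ᶠ ∀ᶠ B)
      conj = ∀gen (⊢⊃ (app (use (∀-elim-shift (shift A →ᶠ B)) (fst #0)) (snd #0)))

  valid-∀l : ∀ {φ t Γ Δ G} → Valid ((inst φ t ∷ Γ ⇒ Δ) ∷ G) → Valid ((∀ᶠ φ ∷ Γ ⇒ Δ) ∷ G)
  valid-∀l = valid-antecedent-mono ∀e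

  valid-∃r : ∀ Δ {ψ t Γ G} → Valid ((Γ ⇒ Δ ∷ʳ inst ψ t) ∷ G) → Valid ((Γ ⇒ Δ ∷ʳ ∃ᶠ ψ) ∷ G)
  valid-∃r Δ = valid-succedent-mono Δ ∃i

  valid-∀rms : ∀ {φ Γ G} → Valid ((shiftL Γ ⇒ [ φ ]) ∷ shiftH G) → Valid ((Γ ⇒ [ ∀ᶠ φ ]) ∷ G)
  valid-∀rms {φ} {Γ} {G} (valid p) = valid (closed (use (⋁-cons {Δ = map seqFm G})
    (case (use acd (axiom (∀-intro side-or-sequent)))
      (inr #0)
      (inl (use ∀-⊃-distrib #0)))))
    where
      side-or-sequent : ∀GD⊢ (shift (hseqFm G) ∨ᶠ (shift (⋀ Γ) →ᶠ φ))
      side-or-sequent = closed (case (use (⋁-uncons {Δ = map seqFm (shiftH G)}) (axiom p))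
        (inr (use (≡⇒⊃ (cong (_→ᶠ φ) (sym (shift-⋀ Γ)))) #0))
        (inl (use (≡⇒⊃ (hseqFm-shiftH G)) #0)))

  valid-∃l : ∀ {φ Γ Δ} → Valid [ φ ∷ shiftL Γ ⇒ shiftL Δ ] → Valid [ ∃ᶠ φ ∷ Γ ⇒ Δ ]
  valid-∃l {φ} {Γ} {Δ} (valid p) =
    valid (⊢⊃ (let x = use (⋀-uncons {Γ = Γ}) #0 in app (use ∃φ⊃sequent (fst x)) (snd x)))
    where
      ∃φ⊃sequent : ∀GD⊢ (∃ᶠ φ →ᶠ ⋀ Γ →ᶠ ⋁ Δ)
      ∃φ⊃sequent = ∃gen (⊢⊃ (lam (use (≡⇒⊃ (sym (shift-⋁ Δ)))
        (app (axiom p) (use (⋀-cons {Γ = shiftL Γ}) (pair #1 (use (≡⇒⊃ (shift-⋀ Γ)) #0)))))))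

  sound : ∀ {H} → ∀HLJ'rs H → Valid H
  sound (ax _)                    = valid-ax
  sound (ax⊥ _)                   = valid-ax⊥
  sound (ew d)                    = valid-ew (sound d)
  sound (ec d)                    = valid-ec (sound d)
  sound (ee {G} d)                = valid-ee G (sound d)
  sound (iwl d)                   = valid-iwl (sound d)
  sound (iwr {Δ = Δ} d)           = valid-iwr Δ (sound d)
  sound (icl d)                   = valid-icl (sound d)
  sound (icr {Δ = Δ} d)           = valid-icr Δ (sound d)
  sound (iel {Γ₁ = Γ₁} d)         = valid-iel Γ₁ (sound d)
  sound (ier {Δ₁ = Δ₁} d)         = valid-ier Δ₁ (sound d)
  sound (cut {Γ₀ = Γ₀} {Δ₀} d e)  = valid-cut Γ₀ Δ₀ (sound d) (sound e)
  sound (→l {Δ = Δ} d e)          = valid-→l Δ (sound d) (sound e)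
  sound (→r d)                    = valid-→r (sound d)
  sound (∨l d e)                  = valid-∨l (sound d) (sound e)
  sound (∨r₁ {Δ = Δ} d)           = valid-∨r₁ Δ (sound d)
  sound (∨r₂ {Δ = Δ} d)           = valid-∨r₂ Δ (sound d)
  sound (∧l₁ d)                   = valid-∧l₁ (sound d)
  sound (∧l₂ d)                   = valid-∧l₂ (sound d)
  sound (∧r {Δ = Δ} d e)          = valid-∧r Δ (sound d) (sound e)
  sound (∀l d)                    = valid-∀l (sound d)
  sound (∀r d)                    = valid-∀rms {G = []} (sound d)
  sound (∃l d)                    = valid-∃l (sound d)
  sound (∃r {Δ = Δ} d)            = valid-∃r Δ (sound d)
  sound (∀rms d)                  = valid-∀rms (sound d)
  sound (rs {Δ₁ = Δ₁} d)          = valid-rs Δ₁ (sound d)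

  soundness : ∀ {H} → ∀HLJ'rs H → ∀GD⊢ (closure (hseqFm H))
  soundness {H} d = ∀ⁿ-intro (fvF (hseqFm H)) (derivable (sound d))

mainTheorem2 : ((H : Prop.HSeq) → Prop.HLJ'rs H → Prop.GD⊢ (Prop.hseqFm H))
                 × ((H : Pred.HSeq) → Pred.∀HLJ'rs H → Pred.∀GD⊢ (Pred.closure (Pred.hseqFm H)))
mainTheorem2 = (λ _ → PropositionalSoundness.soundness) , (λ _ → PredicateSoundness.soundness)
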